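{- Let $p$ be a prime. For all $\alpha, \beta$ with $2^{ -10}> \alpha>0$ and $2^{ -10}>\beta >0$ the following holds. Consider partitions $\mathbb{Z}_p= I_0 \sqcup I_1 \sqcup I_2 \sqcup I_3 =J_0 \sqcup J_1 \sqcup J_2 \sqcup J_3$ into consecutive intervals such that $|I_2|+|J_2| \leq (1-\beta/2)p$, $(\alpha/2)|J_2| \leq |I_2| \leq (2/\alpha) |J_2|$, $\min(|I_2|, |J_2|) \ge 24/\beta$ and $$\lfloor (\beta/8) p \rfloor \le \min(|I_1|,|I_3|,|J_1|,|J_3|) \le \max(|I_1|, |I_3|,|J_1|,|J_3|) \le (\beta/4) p.$$ Then there are four families of subsets of $\mathbb{Z}_p$, each consisting of $k \leq 100/ (\alpha \beta)$ sets, $\mathcal{I}_0=\{I^1_0, \dots, I^k_0\}$, $\mathcal{I}_2=\{I^1_2, \dots, I^k_2\}$, $\mathcal{J}_0=\{J_0^1, \dots,J_0^k\}$, $\mathcal{J}_2=\{J_2^1, \dots, J_2^k\}$, such that $\bigcup_i I_0^i = I_0$, $\bigcup_i J_0^i = J_0$, $\bigcup_i I_2^i \subset I_2$ and $\bigcup_i J_2^i \subset J_2$. Furthermore, for every $1 \leq i \leq k$ we have $|I_2^i|=|J_2^i|= \lfloor (\beta/24) \min(|I_2|, |J_2|) \rfloor$ and $(I_0^i+J_2^i) \cap (I_2+J_2) = (J_0^i + I_2^i) \cap (I_2+J_2) = \emptyset$.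
   Context: An interval in $\mathbb{Z}_p$ is a set of consecutive residues $\{a, a+1, \dots, a+m-1\}$. A partition $\mathbb{Z}_p= I_0 \sqcup I_1 \sqcup I_2 \sqcup I_3$ into consecutive intervals means the $I_j$ are pairwise disjoint intervals covering $\mathbb{Z}_p$ appearing in cyclic order $I_0, I_1, I_2, I_3$. $X+Y$ denotes the sumset.
   Formalization: The parameters α and β range over the rationals. -}

module Defs where

open import Data.Nat as ℕ using (ℕ; zero; suc; NonZero)
open import Data.Nat.DivMod using (_mod_)
open import Data.Fin using (Fin; toℕ)
open import Data.Fin.Subset using (Subset; _∈_; ⊥; ⁅_⁆; _∪_)
open import Data.Product using (Σ; ∃; _×_; _,_)
open import Relation.Binary.PropositionalEquality using (_≡_)
open import Data.Integer using (+_)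
open import Data.Rational using (ℚ; _/_)

_+ₚ_ : {p : ℕ} .{{_ : NonZero p}} → Fin p → Fin p → Fin p
_+ₚ_ {p} a b = (toℕ a ℕ.+ toℕ b) mod p

shift : {p : ℕ} .{{_ : NonZero p}} → Fin p → ℕ → Fin p
shift {p} a j = (toℕ a ℕ.+ j) mod p

interval : {p : ℕ} .{{_ : NonZero p}} → Fin p → ℕ → Subset p
interval a zero = ⊥
interval a (suc m) = ⁅ a ⁆ ∪ interval (shift a 1) m

ConsecutivePartition : {p : ℕ} .{{_ : NonZero p}} → (I₀ I₁ I₂ I₃ : Subset p) → Set
ConsecutivePartition {p} I₀ I₁ I₂ I₃ =
  Σ (Fin p) λ s → Σ ℕ λ l₀ → Σ ℕ λ l₁ → Σ ℕ λ l₂ → Σ ℕ λ l₃ →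
    (l₀ ℕ.+ l₁ ℕ.+ l₂ ℕ.+ l₃ ≡ p)
    × (I₀ ≡ interval s l₀)
    × (I₁ ≡ interval (shift s l₀) l₁)
    × (I₂ ≡ interval (shift s (l₀ ℕ.+ l₁)) l₂)
    × (I₃ ≡ interval (shift s (l₀ ℕ.+ l₁ ℕ.+ l₂)) l₃)

_∈⊕_ : {p : ℕ} .{{_ : NonZero p}} → Fin p → Subset p × Subset p → Set
_∈⊕_ {p} x (X , Y) = ∃ λ a → ∃ λ b → a ∈ X × b ∈ Y × x ≡ a +ₚ b

ℕ→ℚ : ℕ → ℚ
ℕ→ℚ n = + n / 1

module Submission where

-- Cut I₀ into at most k = ⌊p / w⌋ + 1 consecutive blocks of length at most w, the shortest of I₁, I₃, J₁, J₃,
-- and pair the block starting c after the start of I₀ with the piece of J₂ of length L = ⌊β min(|I₂|, |J₂|) / 24⌋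
-- starting |J₂| − 1 − |I₃| − c after the start of J₂. Measured from the sum of the two starting points, I₂ + J₂
-- covers [|I₀| + |I₁|, |I₀| + |I₁| + |I₂| + |J₂| − 2], while block + piece lies strictly between the end of that
-- range minus p and its start, because L ≤ w ≤ |I₁|, |I₃| and |I₂| + |J₂| + w + L ≤ p; so it misses I₂ + J₂ in ℤ_p.
-- The hypotheses on α and β give these inequalities and k α β ≤ 17. Exchanging I and J gives the other two families.

module ModularIntervals where

  open import Defs
  open import Data.Nat using (ℕ; zero; suc; NonZero; _+_; _*_; _≤_; _<_; z<s; s<s)
  open import Data.Nat.Properties
  open import Data.Nat.DivMod using (_%_; _mod_; _/_; %-distribˡ-+; m%n%n≡m%n; m<n⇒m%n≡m; m≡m%n+[m/n]*n)
  open import Algebra.Properties.CommutativeSemigroup +-commutativeSemigroup using () renaming (interchange to +-interchange)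
  open import Data.Fin using (Fin; toℕ)
  open import Data.Fin.Properties using (toℕ-fromℕ<; toℕ-injective; toℕ<n)
  open import Data.Fin.Subset using (Subset; _∈_; _∉_; ∣_∣; ⁅_⁆; _∪_; inside; outside)
  open import Data.Fin.Subset.Properties using (x∈p∪q⁻; x∈p∪q⁺; x∈⁅y⁆⇒x≡y; x∈⁅x⁆; ∉⊥; ∣⊥∣≡0; ∪-identityˡ)
  open import Data.Vec using (_∷_; here; there)
  open import Data.Product using (∃; _×_; _,_)
  open import Data.Sum using (inj₁; inj₂)
  open import Data.Empty using (⊥-elim)
  open import Function using (_∘′_)
  open import Relation.Binary.PropositionalEquality

  m%n≡o%n⇒m+n≤o : ∀ {m o} n .{{_ : NonZero n}} → m < o → m % n ≡ o % n → m + n ≤ o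
  m%n≡o%n⇒m+n≤o {m} {o} n m<o eq = begin
    m + n                      ≡⟨ cong (_+ n) (m≡m%n+[m/n]*n m n) ⟩
    m % n + m / n * n + n      ≡⟨ +-assoc (m % n) _ n ⟩
    m % n + (m / n * n + n)    ≡⟨ cong (m % n +_) (+-comm (m / n * n) n) ⟩
    m % n + suc (m / n) * n    ≤⟨ +-monoʳ-≤ (m % n) (*-monoˡ-≤ n m/n<o/n) ⟩
    m % n + o / n * n          ≡⟨ cong (_+ o / n * n) eq ⟩
    o % n + o / n * n          ≡⟨ m≡m%n+[m/n]*n o n ⟨
    o                          ∎
    where
    open ≤-Reasoning
    m/n<o/n : m / n < o / n
    m/n<o/n = *-cancelʳ-< n _ _ (+-cancelˡ-< (m % n) _ _
      (subst₂ _<_ (m≡m%n+[m/n]*n m n) (trans (m≡m%n+[m/n]*n o n) (cong (_+ o / n * n) (sym eq))) m<o))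

  ∣⁅x⁆∪p∣≡1+∣p∣ : ∀ {n} (x : Fin n) (p : Subset n) → x ∉ p → ∣ ⁅ x ⁆ ∪ p ∣ ≡ suc ∣ p ∣
  ∣⁅x⁆∪p∣≡1+∣p∣ Fin.zero    (inside  ∷ p) x∉p = ⊥-elim (x∉p here)
  ∣⁅x⁆∪p∣≡1+∣p∣ Fin.zero    (outside ∷ p) x∉p = cong (suc ∘′ ∣_∣) (∪-identityˡ p)
  ∣⁅x⁆∪p∣≡1+∣p∣ (Fin.suc x) (inside  ∷ p) x∉p = cong suc (∣⁅x⁆∪p∣≡1+∣p∣ x p (x∉p ∘′ there))
  ∣⁅x⁆∪p∣≡1+∣p∣ (Fin.suc x) (outside ∷ p) x∉p = ∣⁅x⁆∪p∣≡1+∣p∣ x p (x∉p ∘′ there)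

  module _ {p : ℕ} .{{_ : NonZero p}} where

    [m%n+o]%n≡[m+o]%n : ∀ m o → (m % p + o) % p ≡ (m + o) % p
    [m%n+o]%n≡[m+o]%n m o = begin
      (m % p + o) % p           ≡⟨ %-distribˡ-+ (m % p) o p ⟩
      (m % p % p + o % p) % p   ≡⟨ cong (λ r → (r + o % p) % p) (m%n%n≡m%n m p) ⟩
      (m % p + o % p) % p       ≡⟨ %-distribˡ-+ m o p ⟨
      (m + o) % p               ∎
      where open ≡-Reasoning

    toℕ-shift : ∀ (a : Fin p) t → toℕ (shift a t) ≡ (toℕ a + t) % p
    toℕ-shift a t = toℕ-fromℕ< _

    toℕ-+ₚ : ∀ (a b : Fin p) → toℕ (a +ₚ b) ≡ (toℕ a + toℕ b) % p
    toℕ-+ₚ a b = toℕ-fromℕ< _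

    shift-zero : ∀ (a : Fin p) → shift a 0 ≡ a
    shift-zero a = toℕ-injective (begin
      toℕ (shift a 0) ≡⟨ toℕ-shift a 0 ⟩
      (toℕ a + 0) % p ≡⟨ cong (_% p) (+-identityʳ (toℕ a)) ⟩
      toℕ a % p       ≡⟨ m<n⇒m%n≡m (toℕ<n a) ⟩
      toℕ a           ∎)
      where open ≡-Reasoning

    shift-shift : ∀ (a : Fin p) t u → shift (shift a t) u ≡ shift a (t + u)
    shift-shift a t u = toℕ-injective (begin
      toℕ (shift (shift a t) u) ≡⟨ toℕ-shift (shift a t) u ⟩
      (toℕ (shift a t) + u) % p ≡⟨ cong (λ r → (r + u) % p) (toℕ-shift a t) ⟩
      ((toℕ a + t) % p + u) % p ≡⟨ [m%n+o]%n≡[m+o]%n (toℕ a + t) u ⟩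
      (toℕ a + t + u) % p       ≡⟨ cong (_% p) (+-assoc (toℕ a) t u) ⟩
      (toℕ a + (t + u)) % p     ≡⟨ toℕ-shift a (t + u) ⟨
      toℕ (shift a (t + u))     ∎)
      where open ≡-Reasoning

    shift-+ₚ : ∀ (a b : Fin p) t u → shift a t +ₚ shift b u ≡ shift (a +ₚ b) (t + u)
    shift-+ₚ a b t u = toℕ-injective (begin
      toℕ (shift a t +ₚ shift b u)            ≡⟨ toℕ-+ₚ (shift a t) (shift b u) ⟩
      (toℕ (shift a t) + toℕ (shift b u)) % p ≡⟨ cong₂ (λ x y → (x + y) % p) (toℕ-shift a t) (toℕ-shift b u) ⟩
      ((toℕ a + t) % p + (toℕ b + u) % p) % p ≡⟨ %-distribˡ-+ (toℕ a + t) (toℕ b + u) p ⟨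
      (toℕ a + t + (toℕ b + u)) % p           ≡⟨ cong (_% p) (+-interchange (toℕ a) t (toℕ b) u) ⟩
      (toℕ a + toℕ b + (t + u)) % p           ≡⟨ [m%n+o]%n≡[m+o]%n (toℕ a + toℕ b) (t + u) ⟨
      ((toℕ a + toℕ b) % p + (t + u)) % p     ≡⟨ cong (λ r → (r + (t + u)) % p) (toℕ-+ₚ a b) ⟨
      (toℕ (a +ₚ b) + (t + u)) % p            ≡⟨ toℕ-shift (a +ₚ b) (t + u) ⟨
      toℕ (shift (a +ₚ b) (t + u))            ∎)
      where open ≡-Reasoning

    +ₚ-comm : ∀ (a b : Fin p) → a +ₚ b ≡ b +ₚ a
    +ₚ-comm a b = cong (_mod p) (+-comm (toℕ a) (toℕ b))

    shift-injective-window : ∀ (a : Fin p) {t u} → t < u → u < t + p → shift a t ≢ shift a u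
    shift-injective-window a {t} {u} t<u u<t+p eq = <⇒≱ u<t+p (+-cancelˡ-≤ (toℕ a) (t + p) u a+t+p≤a+u)
      where
      eq% : (toℕ a + t) % p ≡ (toℕ a + u) % p
      eq% = trans (sym (toℕ-shift a t)) (trans (cong toℕ eq) (toℕ-shift a u))
      a+t+p≤a+u : toℕ a + (t + p) ≤ toℕ a + u
      a+t+p≤a+u = subst (_≤ toℕ a + u) (+-assoc (toℕ a) t p) (m%n≡o%n⇒m+n≤o p (+-monoʳ-< (toℕ a) t<u) eq%)

    ∈-interval⁻ : ∀ (a : Fin p) l {x} → x ∈ interval a l → ∃ λ t → t < l × x ≡ shift a t
    ∈-interval⁻ a zero x∈ = ⊥-elim (∉⊥ x∈)
    ∈-interval⁻ a (suc l) x∈ with x∈p∪q⁻ ⁅ a ⁆ (interval (shift a 1) l) x∈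
    ... | inj₁ x∈⁅a⁆ = 0 , z<s , trans (x∈⁅y⁆⇒x≡y a x∈⁅a⁆) (sym (shift-zero a))
    ... | inj₂ x∈rest with ∈-interval⁻ (shift a 1) l x∈rest
    ...   | t , t<l , refl = suc t , s<s t<l , shift-shift a 1 t

    ∈-interval⁺ : ∀ (a : Fin p) {l t} → t < l → shift a t ∈ interval a l
    ∈-interval⁺ a {suc l} {zero} _ =
      x∈p∪q⁺ (inj₁ (subst (_∈ ⁅ a ⁆) (sym (shift-zero a)) (x∈⁅x⁆ a)))
    ∈-interval⁺ a {suc l} {suc t} (s<s t<l) =
      x∈p∪q⁺ (inj₂ (subst (_∈ interval (shift a 1) l) (shift-shift a 1 t) (∈-interval⁺ (shift a 1) t<l)))

    ∣interval∣ : ∀ (a : Fin p) l → l ≤ p → ∣ interval a l ∣ ≡ l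
    ∣interval∣ a zero    _     = ∣⊥∣≡0 p
    ∣interval∣ a (suc l) 1+l≤p =
      trans (∣⁅x⁆∪p∣≡1+∣p∣ a _ a∉rest) (cong suc (∣interval∣ (shift a 1) l (<⇒≤ 1+l≤p)))
      where
      a∉rest : a ∉ interval (shift a 1) l
      a∉rest a∈ with ∈-interval⁻ (shift a 1) l a∈
      ... | t , t<l , a≡ = shift-injective-window a z<s (<-≤-trans (s<s t<l) 1+l≤p)
                             (trans (shift-zero a) (trans a≡ (shift-shift a 1 t)))

    ∈⊕-comm : ∀ {x : Fin p} {X Y} → x ∈⊕ (X , Y) → x ∈⊕ (Y , X)
    ∈⊕-comm (a , b , a∈X , b∈Y , x≡) = b , a , b∈Y , a∈X , trans x≡ (+ₚ-comm a b)

module Blocks where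

  open import Defs
  open import Data.Nat using (ℕ; NonZero; _+_; _*_; _∸_; _≤_; _<_; _⊓_; _≤?_)
  open import Data.Nat.Properties
  open import Data.Nat.DivMod using (_%_; _/_; m%n<n; m≡m%n+[m/n]*n; m<n*o⇒m/o<n)
  open import Data.Fin using (Fin; toℕ; fromℕ<)
  open import Data.Fin.Properties using (toℕ-fromℕ<)
  open import Data.Fin.Subset using (Subset; _∈_; ∣_∣)
  open import Data.Product using (∃; _×_; _,_)
  open import Data.Empty using (⊥)
  open import Relation.Binary.PropositionalEquality
  open import Data.Nat.Tactic.RingSolver using (solve-∀)
  open import Relation.Nullary using (yes; no)
  open ModularIntervals

  offset : (n l₃ c : ℕ) → ℕ
  offset n l₃ c = (n ∸ 1) ∸ (l₃ + c)

  offset+r<n : ∀ {n l₃ L r} c → L ≤ l₃ → L ≤ n → r < L → offset n l₃ c + r < n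
  offset+r<n {n} {l₃} {L} {r} c L≤l₃ L≤n r<L with n ∸ 1 ≤? l₃ + c
  ... | yes n∸1≤l₃+c rewrite m≤n⇒m∸n≡0 n∸1≤l₃+c = <-≤-trans r<L L≤n
  ... | no  n∸1≰l₃+c = begin-strict
    offset n l₃ c + r        <⟨ +-monoʳ-< (offset n l₃ c) (<-≤-trans r<L (≤-trans L≤l₃ (m≤m+n l₃ c))) ⟩
    offset n l₃ c + (l₃ + c) ≡⟨ m∸n+n≡m (<⇒≤ (≰⇒> n∸1≰l₃+c)) ⟩
    n ∸ 1                    ≤⟨ m∸n≤m n 1 ⟩
    n                        ∎
    where open ≤-Reasoning

  offset-sum<sumset-start : ∀ {n l₀ l₁ l₃ w L r r₂} c →
    r < w → c + r < l₀ → r₂ < L → L ≤ l₁ → n + w + L ≤ l₀ + l₁ + l₃ →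
    c + r + (offset n l₃ c + r₂) < l₀ + l₁
  offset-sum<sumset-start {n} {l₀} {l₁} {l₃} {w} {L} {r} {r₂} c r<w c+r<l₀ r₂<L L≤l₁ room with n ∸ 1 ≤? l₃ + c
  ... | yes n∸1≤l₃+c rewrite m≤n⇒m∸n≡0 n∸1≤l₃+c = <-≤-trans (+-mono-< c+r<l₀ r₂<L) (+-monoʳ-≤ l₀ L≤l₁)
  ... | no  n∸1≰l₃+c = +-cancelʳ-< l₃ _ _ (begin-strict
    c + r + (o + r₂) + l₃   ≡⟨ regroup c r o r₂ l₃ ⟩
    r + r₂ + (o + (l₃ + c)) ≡⟨ cong (r + r₂ +_) (m∸n+n≡m (<⇒≤ (≰⇒> n∸1≰l₃+c))) ⟩
    r + r₂ + (n ∸ 1)        <⟨ +-monoˡ-< (n ∸ 1) (+-mono-< r<w r₂<L) ⟩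
    w + L + (n ∸ 1)         ≤⟨ +-monoʳ-≤ (w + L) (m∸n≤m n 1) ⟩
    w + L + n               ≡⟨ trans (+-comm (w + L) n) (sym (+-assoc n w L)) ⟩
    n + w + L               ≤⟨ room ⟩
    l₀ + l₁ + l₃            ∎)
    where
    open ≤-Reasoning
    o = offset n l₃ c
    regroup : ∀ c r o r₂ l₃ → c + r + (o + r₂) + l₃ ≡ r + r₂ + (o + (l₃ + c))
    regroup = solve-∀

  sumset-end<offset-sum+p : ∀ {n l₀ l₁ l₂ l₃ i j} c r r₂ → i < l₂ → j < n →
    l₀ + l₁ + i + j < c + r + (offset n l₃ c + r₂) + (l₀ + l₁ + l₂ + l₃)
  sumset-end<offset-sum+p {n} {l₀} {l₁} {l₂} {l₃} {i} {j} c r r₂ i<l₂ j<n = begin-strict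
    l₀ + l₁ + i + j         <⟨ +-mono-<-≤ (+-monoʳ-< (l₀ + l₁) i<l₂) j≤l₃+T ⟩
    l₀ + l₁ + l₂ + (l₃ + T) ≡⟨ regroup l₀ l₁ l₂ l₃ T ⟩
    T + (l₀ + l₁ + l₂ + l₃) ∎
    where
    open ≤-Reasoning
    o = offset n l₃ c
    T = c + r + (o + r₂)
    j≤l₃+T : j ≤ l₃ + T
    j≤l₃+T = begin
      j                   ≤⟨ subst (j ≤_) (pred[m∸n]≡m∸[1+n] n 0) (<⇒≤pred j<n) ⟩
      n ∸ 1               ≤⟨ m≤n+m∸n (n ∸ 1) (l₃ + c) ⟩
      l₃ + c + o          ≤⟨ +-monoʳ-≤ (l₃ + c) (m≤m+n o r₂) ⟩
      l₃ + c + (o + r₂)   ≡⟨ +-assoc l₃ c (o + r₂) ⟩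
      l₃ + (c + (o + r₂)) ≤⟨ +-monoʳ-≤ l₃ (+-monoˡ-≤ (o + r₂) (m≤m+n c r)) ⟩
      l₃ + T              ∎
    regroup : ∀ l₀ l₁ l₂ l₃ T → l₀ + l₁ + l₂ + (l₃ + T) ≡ T + (l₀ + l₁ + l₂ + l₃)
    regroup = solve-∀

  m<o∸n⇒n+m<o : ∀ {m n o} → m < o ∸ n → n + m < o
  m<o∸n⇒n+m<o {m} {n} {o} m<o∸n = subst (n + m <_) (m+[n∸m]≡n n≤o) (+-monoʳ-< n m<o∸n)
    where
    n≤o : n ≤ o
    n≤o = <⇒≤ (m∸n≢0⇒n<m (λ o∸n≡0 → n≮0 (subst (m <_) o∸n≡0 m<o∸n)))

  n+m<o⇒m<o∸n : ∀ {m n o} → n + m < o → m < o ∸ n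
  n+m<o⇒m<o∸n {m} {n} n+m<o = subst (_< _) (m+n∸m≡n n m) (∸-monoˡ-< n+m<o (m≤m+n n m))

  summands≤ : ∀ {a b c d n} → a + b + c + d ≡ n → a ≤ n × b ≤ n × c ≤ n × d ≤ n
  summands≤ {a} {b} {c} {d} refl =
      ≤-trans (m≤m+n a b) (≤-trans (m≤m+n _ c) (m≤m+n _ d))
    , ≤-trans (m≤n+m b a) (≤-trans (m≤m+n _ c) (m≤m+n _ d))
    , ≤-trans (m≤n+m c (a + b)) (m≤m+n _ d)
    , m≤n+m d (a + b + c)

  _⋃≐_ : ∀ {p k} → (Fin k → Subset p) → Subset p → Set
  𝓧 ⋃≐ X = ∀ x → (x ∈ X → ∃ λ i → x ∈ 𝓧 i) × ((∃ λ i → x ∈ 𝓧 i) → x ∈ X)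

  module _ {p : ℕ} .{{_ : NonZero p}} (s : Fin p) (w l₀ : ℕ) where

    block : ℕ → Subset p
    block c = interval (shift s c) (w ⊓ (l₀ ∸ c))

    ∈-block⁻ : ∀ c {x} → x ∈ block c → ∃ λ r → r < w × c + r < l₀ × x ≡ shift s (c + r)
    ∈-block⁻ c x∈ with ∈-interval⁻ (shift s c) (w ⊓ (l₀ ∸ c)) x∈
    ... | r , r<w⊓ , refl =
      r , <-≤-trans r<w⊓ (m⊓n≤m w _) , m<o∸n⇒n+m<o (<-≤-trans r<w⊓ (m⊓n≤n w _)) , shift-shift s c r

    blocks-cover : ∀ k .{{_ : NonZero w}} → l₀ ≤ k * w → (λ (i : Fin k) → block (toℕ i * w)) ⋃≐ interval s l₀
    blocks-cover k l₀≤kw x = into , out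
      where
      into : x ∈ interval s l₀ → ∃ λ (i : Fin k) → x ∈ block (toℕ i * w)
      into x∈ with ∈-interval⁻ s l₀ x∈
      ... | t , t<l₀ , refl = i , subst (_∈ block (toℕ i * w)) shift≡ (∈-interval⁺ (shift s (toℕ i * w)) r<)
        where
        t/w<k : t / w < k
        t/w<k = m<n*o⇒m/o<n (<-≤-trans t<l₀ l₀≤kw)
        i : Fin k
        i = fromℕ< t/w<k
        t≡ : toℕ i * w + t % w ≡ t
        t≡ = trans (cong (λ q → q * w + t % w) (toℕ-fromℕ< t/w<k)) (trans (+-comm _ (t % w)) (sym (m≡m%n+[m/n]*n t w)))
        shift≡ : shift (shift s (toℕ i * w)) (t % w) ≡ shift s t
        shift≡ = trans (shift-shift s _ (t % w)) (cong (shift s) t≡)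
        r< : t % w < w ⊓ (l₀ ∸ toℕ i * w)
        r< = ⊓-glb (m%n<n t w) (n+m<o⇒m<o∸n (subst (_< l₀) (sym t≡) t<l₀))
      out : (∃ λ (i : Fin k) → x ∈ block (toℕ i * w)) → x ∈ interval s l₀
      out (i , x∈) with ∈-block⁻ (toℕ i * w) x∈
      ... | r , _ , c+r<l₀ , refl = ∈-interval⁺ s c+r<l₀

  module _ {p : ℕ} .{{_ : NonZero p}} (b : Fin p) (n l₃ L : ℕ) where

    partner : ℕ → Subset p
    partner c = interval (shift b (offset n l₃ c)) L

    partner⊆interval : ∀ c → L ≤ l₃ → L ≤ n → ∀ x → x ∈ partner c → x ∈ interval b n
    partner⊆interval c L≤l₃ L≤n x x∈ with ∈-interval⁻ _ L x∈
    ... | r , r<L , refl = subst (_∈ interval b n) (sym (shift-shift b _ r)) (∈-interval⁺ b (offset+r<n c L≤l₃ L≤n r<L))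

  block⊕partner-disjoint : ∀ {p} .{{_ : NonZero p}} (s b : Fin p) {w l₀ l₁ l₂ l₃ n L} c →
    l₀ + l₁ + l₂ + l₃ ≡ p → L ≤ l₁ → n + w + L ≤ l₀ + l₁ + l₃ → ∀ x →
    x ∈⊕ (block s w l₀ c , partner b n l₃ L c) → x ∈⊕ (interval (shift s (l₀ + l₁)) l₂ , interval b n) → ⊥
  block⊕partner-disjoint s b {w} {l₀} {l₁} {l₂} {l₃} {n} {L} c refl L≤l₁ room x
    (y , z , y∈ , z∈ , refl) (y' , z' , y'∈ , z'∈ , eq)
    with ∈-block⁻ s w l₀ c y∈ | ∈-interval⁻ _ L z∈ | ∈-interval⁻ _ l₂ y'∈ | ∈-interval⁻ b n z'∈
  ... | r , r<w , c+r<l₀ , refl | r₂ , r₂<L , refl | i , i<l₂ , refl | j , j<n , refl =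
    shift-injective-window (s +ₚ b) T<Q (sumset-end<offset-sum+p {l₀ = l₀} {l₁} {l₃ = l₃} c r r₂ i<l₂ j<n) (begin
      shift (s +ₚ b) (c + r + (o + r₂))                  ≡⟨ shift-+ₚ s b (c + r) (o + r₂) ⟨
      shift s (c + r) +ₚ shift b (o + r₂)                ≡⟨ cong (shift s (c + r) +ₚ_) (shift-shift b o r₂) ⟨
      shift s (c + r) +ₚ shift (shift b o) r₂            ≡⟨ eq ⟩
      shift (shift s (l₀ + l₁)) i +ₚ shift b j           ≡⟨ cong (_+ₚ shift b j) (shift-shift s (l₀ + l₁) i) ⟩
      shift s (l₀ + l₁ + i) +ₚ shift b j                 ≡⟨ shift-+ₚ s b (l₀ + l₁ + i) j ⟩
      shift (s +ₚ b) (l₀ + l₁ + i + j)                   ∎)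
    where
    open ≡-Reasoning
    o = offset n l₃ c
    T<Q : c + r + (o + r₂) < l₀ + l₁ + i + j
    T<Q = <-≤-trans (offset-sum<sumset-start c r<w c+r<l₀ r₂<L L≤l₁ room) (≤-trans (m≤m+n _ i) (m≤m+n _ j))

  record Pairing {p} (k L : ℕ) (X₀ X₂ Y₂ : Subset p) .{{_ : NonZero p}} : Set where
    field
      𝓧₀ 𝓨₂ : Fin k → Subset p
      ⋃𝓧₀≐X₀ : 𝓧₀ ⋃≐ X₀
      𝓨₂⊆Y₂ : ∀ i x → x ∈ 𝓨₂ i → x ∈ Y₂
      ∣𝓨₂∣≡L : ∀ i → ∣ 𝓨₂ i ∣ ≡ L
      𝓧₀⊕𝓨₂∩X₂⊕Y₂≡∅ : ∀ i x → x ∈⊕ (𝓧₀ i , 𝓨₂ i) → x ∈⊕ (X₂ , Y₂) → ⊥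

  pairing : ∀ {p} .{{_ : NonZero p}} {X₀ X₁ X₂ X₃ Y₀ Y₁ Y₂ Y₃ : Subset p} {w L k} .{{_ : NonZero w}} →
    ConsecutivePartition X₀ X₁ X₂ X₃ → ConsecutivePartition Y₀ Y₁ Y₂ Y₃ →
    L ≤ w → w ≤ ∣ X₁ ∣ ⊓ ∣ X₃ ∣ → L ≤ ∣ Y₂ ∣ → ∣ X₂ ∣ + ∣ Y₂ ∣ + w + L ≤ p → p ≤ k * w →
    Pairing k L X₀ X₂ Y₂
  pairing {p} {w = w} {L} {k} (s , l₀ , l₁ , l₂ , l₃ , sum , refl , refl , refl , refl)
    (b₀ , m₀ , m₁ , n , m₃ , sumY , _ , _ , refl , _) L≤w w≤∣X₁∣⊓∣X₃∣ L≤∣Y₂∣ room p≤kw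
    with summands≤ sum | summands≤ {m₀} {m₁} {n} {m₃} sumY
  ... | l₀≤p , l₁≤p , l₂≤p , l₃≤p | _ , _ , n≤p , _ = record
      { 𝓧₀ = λ i → block s w l₀ (c i)
      ; 𝓨₂ = λ i → partner b n l₃ L (c i)
      ; ⋃𝓧₀≐X₀ = blocks-cover s w l₀ k (≤-trans l₀≤p p≤kw)
      ; 𝓨₂⊆Y₂ = λ i → partner⊆interval b n l₃ L (c i) L≤l₃ L≤n
      ; ∣𝓨₂∣≡L = λ i → ∣interval∣ _ L (≤-trans L≤n n≤p)
      ; 𝓧₀⊕𝓨₂∩X₂⊕Y₂≡∅ = λ i → block⊕partner-disjoint s b {w} {l₀} {l₁} {l₂} {l₃} {n} {L} (c i) sum L≤l₁ room′
      }
    where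
    b = shift b₀ (m₀ + m₁)
    c : Fin k → ℕ
    c i = toℕ i * w
    L≤l₁ : L ≤ l₁
    L≤l₁ = ≤-trans L≤w (≤-trans w≤∣X₁∣⊓∣X₃∣ (≤-trans (m⊓n≤m _ _) (≤-reflexive (∣interval∣ _ l₁ l₁≤p))))
    L≤l₃ : L ≤ l₃
    L≤l₃ = ≤-trans L≤w (≤-trans w≤∣X₁∣⊓∣X₃∣ (≤-trans (m⊓n≤n _ _) (≤-reflexive (∣interval∣ _ l₃ l₃≤p))))
    L≤n : L ≤ n
    L≤n = ≤-trans L≤∣Y₂∣ (≤-reflexive (∣interval∣ b n n≤p))
    room′ : n + w + L ≤ l₀ + l₁ + l₃
    room′ = +-cancelˡ-≤ l₂ _ _ (begin
      l₂ + (n + w + L)                                               ≡⟨ regroupˡ l₂ n w L ⟩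
      l₂ + n + w + L                                                 ≡⟨ cong₂ (λ x y → x + y + w + L) (∣interval∣ _ l₂ l₂≤p) (∣interval∣ b n n≤p) ⟨
      ∣ interval (shift s (l₀ + l₁)) l₂ ∣ + ∣ interval b n ∣ + w + L ≤⟨ room ⟩
      p                                                              ≡⟨ sum ⟨
      l₀ + l₁ + l₂ + l₃                                              ≡⟨ regroupʳ l₀ l₁ l₂ l₃ ⟩
      l₂ + (l₀ + l₁ + l₃)                                            ∎)
      where
      open ≤-Reasoning
      regroupˡ : ∀ l₂ n w L → l₂ + (n + w + L) ≡ l₂ + n + w + L
      regroupˡ = solve-∀
      regroupʳ : ∀ l₀ l₁ l₂ l₃ → l₀ + l₁ + l₂ + l₃ ≡ l₂ + (l₀ + l₁ + l₃)
      regroupʳ = solve-∀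

module Sizes where

  open import Defs
  open import Data.Nat as ℕ using (ℕ; suc; z≤n; s≤s)
  import Data.Nat.Properties as ℕ
  import Data.Nat.DivMod as ℕ
  import Data.Nat.Coprimality as Coprimality
  open import Data.Integer as ℤ using (+_; -[1+_]; +≤+; +<+)
  import Data.Integer.Properties as ℤ
  open import Data.Rational
  open import Data.Rational.Properties
  import Data.Rational.Unnormalised as ℚᵘ
  open import Data.Rational.Unnormalised.Properties using () renaming (≃-trans to ≃ᵘ-trans; ≃-sym to ≃ᵘ-sym)
  open import Data.Product using (∃; _×_; _,_)
  open import Relation.Binary.PropositionalEquality
  open import Data.Rational.Solver using (module +-*-Solver)
  open +-*-Solver

  ℕ→ℚ≡mkℚ : ∀ n → ℕ→ℚ n ≡ mkℚ (+ n) 0 (Coprimality.sym (Coprimality.1-coprimeTo n))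
  ℕ→ℚ≡mkℚ n = normalize-coprime _

  ℕ→ℚ-nonNeg : ∀ n → NonNegative (ℕ→ℚ n)
  ℕ→ℚ-nonNeg n = normalize-nonNeg n 1

  ℕ→ℚ-mono-≤ : ∀ {m n} → m ℕ.≤ n → ℕ→ℚ m ≤ ℕ→ℚ n
  ℕ→ℚ-mono-≤ {m} {n} m≤n rewrite ℕ→ℚ≡mkℚ m | ℕ→ℚ≡mkℚ n =
    *≤* (subst₂ ℤ._≤_ (sym (ℤ.*-identityʳ (+ m))) (sym (ℤ.*-identityʳ (+ n))) (+≤+ m≤n))

  ℕ→ℚ-cancel-≤ : ∀ {m n} → ℕ→ℚ m ≤ ℕ→ℚ n → m ℕ.≤ n
  ℕ→ℚ-cancel-≤ {m} {n} m≤n rewrite ℕ→ℚ≡mkℚ m | ℕ→ℚ≡mkℚ n with m≤n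
  ... | *≤* m*1≤n*1 with subst₂ ℤ._≤_ (ℤ.*-identityʳ (+ m)) (ℤ.*-identityʳ (+ n)) m*1≤n*1
  ...   | +≤+ m≤n′ = m≤n′

  ℕ→ℚ-cancel-< : ∀ {m n} → ℕ→ℚ m < ℕ→ℚ n → m ℕ.< n
  ℕ→ℚ-cancel-< {m} {n} m<n rewrite ℕ→ℚ≡mkℚ m | ℕ→ℚ≡mkℚ n with m<n
  ... | *<* m*1<n*1 with subst₂ ℤ._<_ (ℤ.*-identityʳ (+ m)) (ℤ.*-identityʳ (+ n)) m*1<n*1
  ...   | +<+ m<n′ = m<n′

  ℕ→ℚ-+ : ∀ m n → ℕ→ℚ (m ℕ.+ n) ≡ ℕ→ℚ m + ℕ→ℚ n
  ℕ→ℚ-+ m n = toℚᵘ-injective (≃ᵘ-trans toℚᵘ-lhs (≃ᵘ-sym (toℚᵘ-homo-+ (ℕ→ℚ m) (ℕ→ℚ n))))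
    where
    toℚᵘ-lhs : toℚᵘ (ℕ→ℚ (m ℕ.+ n)) ℚᵘ.≃ toℚᵘ (ℕ→ℚ m) ℚᵘ.+ toℚᵘ (ℕ→ℚ n)
    toℚᵘ-lhs rewrite ℕ→ℚ≡mkℚ m | ℕ→ℚ≡mkℚ n | ℕ→ℚ≡mkℚ (m ℕ.+ n) =
      ℚᵘ.*≡* (cong (ℤ._* + 1) (trans (ℤ.pos-+ m n) (sym (cong₂ ℤ._+_ (ℤ.*-identityʳ (+ m)) (ℤ.*-identityʳ (+ n))))))

  ℕ→ℚ-* : ∀ m n → ℕ→ℚ (m ℕ.* n) ≡ ℕ→ℚ m * ℕ→ℚ n
  ℕ→ℚ-* m n = toℚᵘ-injective (≃ᵘ-trans toℚᵘ-lhs (≃ᵘ-sym (toℚᵘ-homo-* (ℕ→ℚ m) (ℕ→ℚ n))))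
    where
    toℚᵘ-lhs : toℚᵘ (ℕ→ℚ (m ℕ.* n)) ℚᵘ.≃ toℚᵘ (ℕ→ℚ m) ℚᵘ.* toℚᵘ (ℕ→ℚ n)
    toℚᵘ-lhs rewrite ℕ→ℚ≡mkℚ m | ℕ→ℚ≡mkℚ n | ℕ→ℚ≡mkℚ (m ℕ.* n) =
      ℚᵘ.*≡* (cong (ℤ._* + 1) (ℤ.pos-* m n))

  floor-nonNeg : ∀ q → 0ℚ ≤ q → ∃ λ L → floor q ≡ + L × ℕ→ℚ L ≤ q
  floor-nonNeg (mkℚ -[1+ _ ] _ _) (*≤* ())
  floor-nonNeg (mkℚ (+ n) d-1 _) _ = n ℕ./ suc d-1 , ℤ.*-identityˡ _ , L≤q
    where
    L≤q : ℕ→ℚ (n ℕ./ suc d-1) ≤ mkℚ (+ n) d-1 _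
    L≤q rewrite ℕ→ℚ≡mkℚ (n ℕ./ suc d-1) = *≤* (subst₂ ℤ._≤_ (ℤ.pos-* (n ℕ./ suc d-1) (suc d-1))
      (sym (ℤ.*-identityʳ (+ n))) (+≤+ (ℕ.m/n*n≤m n (suc d-1))))

  floor≤⇒<suc : ∀ q w → 0ℚ ≤ q → floor q ℤ.≤ + w → q < ℕ→ℚ (suc w)
  floor≤⇒<suc (mkℚ -[1+ _ ] _ _) _ (*≤* ()) _
  floor≤⇒<suc (mkℚ (+ n) d-1 _) w _ ⌊q⌋≤w rewrite ℕ→ℚ≡mkℚ (suc w)
    with subst (ℤ._≤ + w) (ℤ.*-identityˡ _) ⌊q⌋≤w
  ... | +≤+ n/d≤w = *<* (subst₂ ℤ._<_ (sym (ℤ.*-identityʳ (+ n))) (ℤ.pos-* (suc w) (suc d-1)) (+<+ n<[1+w]d))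
    where
    n<[1+w]d : n ℕ.< suc w ℕ.* suc d-1
    n<[1+w]d = subst (ℕ._< suc w ℕ.* suc d-1) (sym (ℕ.m≡m%n+[m/n]*n n (suc d-1)))
      (ℕ.+-mono-<-≤ (ℕ.m%n<n n (suc d-1)) (ℕ.*-monoˡ-≤ (suc d-1) n/d≤w))

  [p/w+1]αβ≤100 : ∀ p w (α β : ℚ) .{{_ : ℕ.NonZero w}} .{{_ : NonNegative β}} → α ≤ 1ℚ → β ≤ 1ℚ →
    β * (+ 1 / 8) * ℕ→ℚ p < ℕ→ℚ (suc w) → ℕ→ℚ (p ℕ./ w ℕ.+ 1) * (α * β) ≤ ℕ→ℚ 100
  [p/w+1]αβ≤100 p w α β α≤1 β≤1 βp/8<1+w = begin
    ℕ→ℚ (p ℕ./ w ℕ.+ 1) * (α * β) ≡⟨ cong (_* (α * β)) (ℕ→ℚ-+ (p ℕ./ w) 1) ⟩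
    (K + 1ℚ) * (α * β)            ≡⟨ solve 3 (λ K α β → (K :+ con 1ℚ) :* (α :* β) := α :* (β :* K :+ β)) refl K α β ⟩
    α * (β * K + β)               ≤⟨ *-monoʳ-≤-nonNeg (β * K + β) α≤1 ⟩
    1ℚ * (β * K + β)              ≡⟨ *-identityˡ (β * K + β) ⟩
    β * K + β                     ≤⟨ +-mono-≤ (<⇒≤ βK<16) β≤1 ⟩
    ℕ→ℚ 16 + 1ℚ                   ≤⟨ *≤* (+≤+ (ℕ.m≤m+n 17 83)) ⟩
    ℕ→ℚ 100                       ∎
    where
    open ≤-Reasoning
    K = ℕ→ℚ (p ℕ./ w)
    W = ℕ→ℚ w
    instance
      βK-nonNeg : NonNegative (β * K)
      βK-nonNeg = nonNeg*nonNeg⇒nonNeg β K {{ℕ→ℚ-nonNeg (p ℕ./ w)}}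
      βK+β-nonNeg : NonNegative (β * K + β)
      βK+β-nonNeg = nonNeg+nonNeg⇒nonNeg (β * K) β
    βK<16 : β * K < ℕ→ℚ 16
    βK<16 = *-cancelʳ-<-nonNeg W {{ℕ→ℚ-nonNeg w}} (begin-strict
      β * K * W                      ≡⟨ *-assoc β K W ⟩
      β * (K * W)                    ≡⟨ cong (β *_) (ℕ→ℚ-* (p ℕ./ w) w) ⟨
      β * ℕ→ℚ (p ℕ./ w ℕ.* w)        ≤⟨ *-monoˡ-≤-nonNeg β (ℕ→ℚ-mono-≤ (ℕ.m/n*n≤m p w)) ⟩
      β * ℕ→ℚ p                      ≡⟨ solve 2 (λ β P → β :* P := con (ℕ→ℚ 8) :* (β :* con (+ 1 / 8) :* P)) refl β (ℕ→ℚ p) ⟩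
      ℕ→ℚ 8 * (β * (+ 1 / 8) * ℕ→ℚ p) <⟨ *-monoʳ-<-pos (ℕ→ℚ 8) βp/8<1+w ⟩
      ℕ→ℚ 8 * ℕ→ℚ (suc w)             ≡⟨ ℕ→ℚ-* 8 (suc w) ⟨
      ℕ→ℚ (8 ℕ.* suc w)               ≤⟨ ℕ→ℚ-mono-≤ 8[1+w]≤16w ⟩
      ℕ→ℚ (16 ℕ.* w)                  ≡⟨ ℕ→ℚ-* 16 w ⟩
      ℕ→ℚ 16 * W                      ∎)
      where
      8[1+w]≤16w : 8 ℕ.* suc w ℕ.≤ 16 ℕ.* w
      8[1+w]≤16w = ℕ.≤-trans (ℕ.≤-reflexive (ℕ.*-suc 8 w))
        (ℕ.≤-trans (ℕ.+-monoˡ-≤ (8 ℕ.* w) (ℕ.m≤m*n 8 w)) (ℕ.≤-reflexive (sym (ℕ.*-distribʳ-+ w 8 8))))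

  record BlockSizes (p m n w : ℕ) (α β : ℚ) : Set where
    field
      L k : ℕ
      ⌊β/24·m⊓n⌋≡L : floor (β * (+ 1 / 24) * ℕ→ℚ (m ℕ.⊓ n)) ≡ + L
      w≢0 : ℕ.NonZero w
      L≤w : L ℕ.≤ w
      L≤m⊓n : L ℕ.≤ m ℕ.⊓ n
      m+n+w+L≤p : m ℕ.+ n ℕ.+ w ℕ.+ L ℕ.≤ p
      p≤k*w : p ℕ.≤ k ℕ.* w
      kαβ≤100 : ℕ→ℚ k * (α * β) ≤ ℕ→ℚ 100

  m≤[m/n+1]*n : ∀ m n .{{_ : ℕ.NonZero n}} → m ℕ.≤ (m ℕ./ n ℕ.+ 1) ℕ.* n
  m≤[m/n+1]*n m n = begin
    m                         ≡⟨ ℕ.m≡m%n+[m/n]*n m n ⟩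
    m ℕ.% n ℕ.+ m ℕ./ n ℕ.* n ≤⟨ ℕ.+-monoˡ-≤ (m ℕ./ n ℕ.* n) (ℕ.m%n≤n m n) ⟩
    n ℕ.+ m ℕ./ n ℕ.* n       ≡⟨ ℕ.+-comm n _ ⟩
    m ℕ./ n ℕ.* n ℕ.+ n       ≡⟨ cong (m ℕ./ n ℕ.* n ℕ.+_) (ℕ.*-identityˡ n) ⟨
    m ℕ./ n ℕ.* n ℕ.+ 1 ℕ.* n ≡⟨ ℕ.*-distribʳ-+ n (m ℕ./ n) 1 ⟨
    (m ℕ./ n ℕ.+ 1) ℕ.* n     ∎
    where open ℕ.≤-Reasoning

  p≤p+q : ∀ p q .{{_ : NonNegative q}} → p ≤ p + q
  p≤p+q p q = subst (_≤ p + q) (+-identityʳ p) (+-monoʳ-≤ p (nonNegative⁻¹ q))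

  block-sizes : ∀ p m n w W (α β : ℚ) → 0ℚ < α → α < + 1 / 1024 → 0ℚ < β → β < + 1 / 1024 →
    m ℕ.≤ p → w ℕ.≤ W →
    ℕ→ℚ (m ℕ.+ n) ≤ (1ℚ - β * ½) * ℕ→ℚ p →
    ℕ→ℚ 24 ≤ β * ℕ→ℚ (m ℕ.⊓ n) →
    floor (β * (+ 1 / 8) * ℕ→ℚ p) ℤ.≤ + w →
    ℕ→ℚ W ≤ β * (+ 1 / 4) * ℕ→ℚ p →
    BlockSizes p m n w α β
  block-sizes p m n w W α β 0<α α<ε 0<β β<ε m≤p w≤W m+n≤[1-β/2]p 24≤β[m⊓n] ⌊βp/8⌋≤w W≤βp/4 =
    sizes (floor-nonNeg (β * (+ 1 / 24) * M) (β*c*x≥0 (+ 1 / 24) (m ℕ.⊓ n)))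
    where
    open ≤-Reasoning
    P = ℕ→ℚ p
    M = ℕ→ℚ (m ℕ.⊓ n)
    instance
      β-nonNeg : NonNegative β
      β-nonNeg = nonNegative (<⇒≤ 0<β)
    β*c*x-nonNeg : ∀ c .{{_ : NonNegative c}} x → NonNegative (β * c * ℕ→ℚ x)
    β*c*x-nonNeg c x = nonNeg*nonNeg⇒nonNeg (β * c) {{nonNeg*nonNeg⇒nonNeg β c}} (ℕ→ℚ x) {{ℕ→ℚ-nonNeg x}}
    β*c*x≥0 : ∀ c .{{_ : NonNegative c}} x → 0ℚ ≤ β * c * ℕ→ℚ x
    β*c*x≥0 c x = nonNegative⁻¹ _ {{β*c*x-nonNeg c x}}
    ε≤1 : + 1 / 1024 ≤ 1ℚ
    ε≤1 = *≤* (+≤+ (s≤s z≤n))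
    α≤1 : α ≤ 1ℚ
    α≤1 = ≤-trans (<⇒≤ α<ε) ε≤1
    β≤1 : β ≤ 1ℚ
    β≤1 = ≤-trans (<⇒≤ β<ε) ε≤1
    M≤P : M ≤ P
    M≤P = ℕ→ℚ-mono-≤ (ℕ.≤-trans (ℕ.m⊓n≤m m n) m≤p)
    βP/8<1+w : β * (+ 1 / 8) * P < ℕ→ℚ (suc w)
    βP/8<1+w = floor≤⇒<suc _ w (β*c*x≥0 (+ 1 / 8) p) ⌊βp/8⌋≤w
    3≤βP/8 : ℕ→ℚ 3 ≤ β * (+ 1 / 8) * P
    3≤βP/8 = begin
      ℕ→ℚ 3               ≡⟨⟩
      ℕ→ℚ 24 * (+ 1 / 8)  ≤⟨ *-monoʳ-≤-nonNeg (+ 1 / 8) (≤-trans 24≤β[m⊓n] (*-monoˡ-≤-nonNeg β M≤P)) ⟩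
      β * P * (+ 1 / 8)   ≡⟨ solve 2 (λ β P → β :* P :* con (+ 1 / 8) := β :* con (+ 1 / 8) :* P) refl β P ⟩
      β * (+ 1 / 8) * P   ∎
    instance
      w≢0 : ℕ.NonZero w
      w≢0 = ℕ.>-nonZero (ℕ.<-≤-trans ℕ.z<s (ℕ.s≤s⁻¹ (ℕ→ℚ-cancel-< {3} (≤-<-trans 3≤βP/8 βP/8<1+w))))
    sizes : (∃ λ L → floor (β * (+ 1 / 24) * M) ≡ + L × ℕ→ℚ L ≤ β * (+ 1 / 24) * M) → BlockSizes p m n w α β
    sizes (L , ⌊βM/24⌋≡L , L≤βM/24) = record
      { L = L
      ; k = p ℕ./ w ℕ.+ 1
      ; w≢0 = w≢0
      ; ⌊β/24·m⊓n⌋≡L = ⌊βM/24⌋≡L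
      ; L≤w = ℕ.≤-trans (ℕ.m≤n*m L 3) (ℕ.s≤s⁻¹ (ℕ→ℚ-cancel-< {3 ℕ.* L} (≤-<-trans 3L≤βP/8 βP/8<1+w)))
      ; L≤m⊓n = ℕ→ℚ-cancel-≤ (begin
          ℕ→ℚ L                 ≤⟨ L≤βM/24 ⟩
          β * (+ 1 / 24) * M    ≤⟨ *-monoʳ-≤-nonNeg M {{ℕ→ℚ-nonNeg (m ℕ.⊓ n)}} β/24≤1 ⟩
          1ℚ * M                ≡⟨ *-identityˡ M ⟩
          M                     ∎)
      ; m+n+w+L≤p = ℕ→ℚ-cancel-≤ (begin
          ℕ→ℚ (m ℕ.+ n ℕ.+ w ℕ.+ L)
            ≡⟨ trans (ℕ→ℚ-+ (m ℕ.+ n ℕ.+ w) L) (cong (_+ ℕ→ℚ L) (ℕ→ℚ-+ (m ℕ.+ n) w)) ⟩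
          ℕ→ℚ (m ℕ.+ n) + ℕ→ℚ w + ℕ→ℚ L
            ≤⟨ +-mono-≤ (+-mono-≤ m+n≤[1-β/2]p (≤-trans (ℕ→ℚ-mono-≤ w≤W) W≤βp/4)) L≤βP/24 ⟩
          (1ℚ - β * ½) * P + β * (+ 1 / 4) * P + β * (+ 1 / 24) * P
            ≤⟨ p≤p+q _ (β * (+ 5 / 24) * P) {{β*c*x-nonNeg (+ 5 / 24) p}} ⟩
          (1ℚ - β * ½) * P + β * (+ 1 / 4) * P + β * (+ 1 / 24) * P + β * (+ 5 / 24) * P
            ≡⟨ solve 2 (λ β P → (con 1ℚ :- β :* con ½) :* P :+ β :* con (+ 1 / 4) :* P :+ β :* con (+ 1 / 24) :* P
                                  :+ β :* con (+ 5 / 24) :* P := P) refl β P ⟩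
          P ∎)
      ; p≤k*w = m≤[m/n+1]*n p w
      ; kαβ≤100 = [p/w+1]αβ≤100 p w α β α≤1 β≤1 βP/8<1+w
      }
      where
      L≤βP/24 : ℕ→ℚ L ≤ β * (+ 1 / 24) * P
      L≤βP/24 = ≤-trans L≤βM/24 (*-monoˡ-≤-nonNeg (β * (+ 1 / 24)) {{nonNeg*nonNeg⇒nonNeg β (+ 1 / 24)}} M≤P)
      3L≤βP/8 : ℕ→ℚ (3 ℕ.* L) ≤ β * (+ 1 / 8) * P
      3L≤βP/8 = begin
        ℕ→ℚ (3 ℕ.* L)                ≡⟨ ℕ→ℚ-* 3 L ⟩
        ℕ→ℚ 3 * ℕ→ℚ L                ≤⟨ *-monoˡ-≤-nonNeg (ℕ→ℚ 3) L≤βP/24 ⟩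
        ℕ→ℚ 3 * (β * (+ 1 / 24) * P) ≡⟨ solve 2 (λ β P → con (ℕ→ℚ 3) :* (β :* con (+ 1 / 24) :* P) := β :* con (+ 1 / 8) :* P) refl β P ⟩
        β * (+ 1 / 8) * P            ∎
      β/24≤1 : β * (+ 1 / 24) ≤ 1ℚ
      β/24≤1 = ≤-trans (*-monoʳ-≤-nonNeg (+ 1 / 24) β≤1) (*≤* (+≤+ (s≤s z≤n)))

open import Defs
open import Data.Nat as ℕ using (ℕ; NonZero; _⊓_; _⊔_)
open import Data.Nat.Primality using (Prime)
open import Data.Fin using (Fin)
open import Data.Fin.Subset using (Subset; _∈_; ∣_∣)
open import Data.Product using (Σ; ∃; _×_; _,_)
open import Data.Empty using (⊥)
open import Relation.Binary.PropositionalEquality using (_≡_; sym; trans; cong; subst)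
open import Data.Integer as ℤ using (+_)
open import Data.Rational using (ℚ; _/_; _<_; _≤_; _*_; _-_; floor; 0ℚ; 1ℚ; ½)
open import Data.Nat.Properties using (≤-trans; m⊓n≤m; m⊓n≤n; m≤m⊔n; ⊓-glb; +-comm)
open import Data.Fin.Subset.Properties using (∣p∣≤n)
open ModularIntervals using (∈⊕-comm)
open Blocks using (Pairing; pairing)
open Sizes using (BlockSizes; block-sizes)

lemma12 : (p : ℕ) .{{_ : NonZero p}} → Prime p →
    (α β : ℚ) → 0ℚ < α → α < + 1 / 1024 → 0ℚ < β → β < + 1 / 1024 →
    (I₀ I₁ I₂ I₃ J₀ J₁ J₂ J₃ : Subset p) →
    ConsecutivePartition I₀ I₁ I₂ I₃ → ConsecutivePartition J₀ J₁ J₂ J₃ →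
    ℕ→ℚ (∣ I₂ ∣ ℕ.+ ∣ J₂ ∣) ≤ (1ℚ - β * ½) * ℕ→ℚ p →
    (α * ½) * ℕ→ℚ ∣ J₂ ∣ ≤ ℕ→ℚ ∣ I₂ ∣ →
    α * ℕ→ℚ ∣ I₂ ∣ ≤ ℕ→ℚ 2 * ℕ→ℚ ∣ J₂ ∣ →
    ℕ→ℚ 24 ≤ β * ℕ→ℚ (∣ I₂ ∣ ⊓ ∣ J₂ ∣) →
    floor (β * (+ 1 / 8) * ℕ→ℚ p) ℤ.≤ + (∣ I₁ ∣ ⊓ ∣ I₃ ∣ ⊓ ∣ J₁ ∣ ⊓ ∣ J₃ ∣) →
    ℕ→ℚ (∣ I₁ ∣ ⊔ ∣ I₃ ∣ ⊔ ∣ J₁ ∣ ⊔ ∣ J₃ ∣) ≤ β * (+ 1 / 4) * ℕ→ℚ p →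
    ∃ λ (k : ℕ) → (ℕ→ℚ k * (α * β) ≤ ℕ→ℚ 100) ×
      Σ (Fin k → Subset p) λ 𝓘₀ → Σ (Fin k → Subset p) λ 𝓘₂ →
      Σ (Fin k → Subset p) λ 𝓙₀ → Σ (Fin k → Subset p) λ 𝓙₂ →
        (∀ x → (x ∈ I₀ → ∃ λ i → x ∈ 𝓘₀ i) × ((∃ λ i → x ∈ 𝓘₀ i) → x ∈ I₀))
        × (∀ x → (x ∈ J₀ → ∃ λ i → x ∈ 𝓙₀ i) × ((∃ λ i → x ∈ 𝓙₀ i) → x ∈ J₀))
        × (∀ i x → x ∈ 𝓘₂ i → x ∈ I₂)
        × (∀ i x → x ∈ 𝓙₂ i → x ∈ J₂)
        × (∀ i → (+ ∣ 𝓘₂ i ∣ ≡ floor (β * (+ 1 / 24) * ℕ→ℚ (∣ I₂ ∣ ⊓ ∣ J₂ ∣)))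
               × (+ ∣ 𝓙₂ i ∣ ≡ floor (β * (+ 1 / 24) * ℕ→ℚ (∣ I₂ ∣ ⊓ ∣ J₂ ∣)))
               × (∀ x → x ∈⊕ (𝓘₀ i , 𝓙₂ i) → x ∈⊕ (I₂ , J₂) → ⊥)
               × (∀ x → x ∈⊕ (𝓙₀ i , 𝓘₂ i) → x ∈⊕ (I₂ , J₂) → ⊥))
lemma12 p _ α β 0<α α<ε 0<β β<ε I₀ I₁ I₂ I₃ J₀ J₁ J₂ J₃ cpI cpJ
  ∣I₂∣+∣J₂∣≤[1-β/2]p _ _ 24≤β[∣I₂∣⊓∣J₂∣] ⌊βp/8⌋≤w W≤βp/4 =
  k , kαβ≤100 , 𝓘₀ , 𝓘₂ , 𝓙₀ , 𝓙₂ , ⋃𝓘₀≐I₀ , ⋃𝓙₀≐J₀ , 𝓘₂⊆I₂ , 𝓙₂⊆J₂ , λ i →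
    trans (cong +_ (∣𝓘₂∣≡L i)) (sym ⌊β/24·m⊓n⌋≡L) ,
    trans (cong +_ (∣𝓙₂∣≡L i)) (sym ⌊β/24·m⊓n⌋≡L) ,
    𝓘₀⊕𝓙₂∩I₂⊕J₂≡∅ i ,
    λ x x∈𝓙₀⊕𝓘₂ x∈I₂⊕J₂ → 𝓙₀⊕𝓘₂∩J₂⊕I₂≡∅ i x x∈𝓙₀⊕𝓘₂ (∈⊕-comm x∈I₂⊕J₂)
  where
  w = ∣ I₁ ∣ ⊓ ∣ I₃ ∣ ⊓ ∣ J₁ ∣ ⊓ ∣ J₃ ∣
  w≤∣I₁∣⊓∣I₃∣ : w ℕ.≤ ∣ I₁ ∣ ⊓ ∣ I₃ ∣
  w≤∣I₁∣⊓∣I₃∣ = ≤-trans (m⊓n≤m _ _) (m⊓n≤m _ _)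
  w≤∣J₁∣⊓∣J₃∣ : w ℕ.≤ ∣ J₁ ∣ ⊓ ∣ J₃ ∣
  w≤∣J₁∣⊓∣J₃∣ = ⊓-glb (≤-trans (m⊓n≤m _ _) (m⊓n≤n _ _)) (m⊓n≤n _ _)
  w≤W : w ℕ.≤ ∣ I₁ ∣ ⊔ ∣ I₃ ∣ ⊔ ∣ J₁ ∣ ⊔ ∣ J₃ ∣
  w≤W = ≤-trans w≤∣I₁∣⊓∣I₃∣ (≤-trans (m⊓n≤m _ _) (≤-trans (m≤m⊔n _ _) (≤-trans (m≤m⊔n _ _) (m≤m⊔n _ _))))
  open BlockSizes (block-sizes p ∣ I₂ ∣ ∣ J₂ ∣ w _ α β 0<α α<ε 0<β β<ε (∣p∣≤n I₂) w≤W
    ∣I₂∣+∣J₂∣≤[1-β/2]p 24≤β[∣I₂∣⊓∣J₂∣] ⌊βp/8⌋≤w W≤βp/4)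
  instance
    w≢0′ : NonZero w
    w≢0′ = w≢0
  open Pairing (pairing {L = L} {k} cpI cpJ L≤w w≤∣I₁∣⊓∣I₃∣ (≤-trans L≤m⊓n (m⊓n≤n _ _)) m+n+w+L≤p p≤k*w)
    renaming (𝓧₀ to 𝓘₀; 𝓨₂ to 𝓙₂; ⋃𝓧₀≐X₀ to ⋃𝓘₀≐I₀; 𝓨₂⊆Y₂ to 𝓙₂⊆J₂; ∣𝓨₂∣≡L to ∣𝓙₂∣≡L;
              𝓧₀⊕𝓨₂∩X₂⊕Y₂≡∅ to 𝓘₀⊕𝓙₂∩I₂⊕J₂≡∅)
  open Pairing (pairing {L = L} {k} cpJ cpI L≤w w≤∣J₁∣⊓∣J₃∣ (≤-trans L≤m⊓n (m⊓n≤m _ _))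
                  (subst (λ m → m ℕ.+ w ℕ.+ L ℕ.≤ p) (+-comm ∣ I₂ ∣ ∣ J₂ ∣) m+n+w+L≤p) p≤k*w)
    renaming (𝓧₀ to 𝓙₀; 𝓨₂ to 𝓘₂; ⋃𝓧₀≐X₀ to ⋃𝓙₀≐J₀; 𝓨₂⊆Y₂ to 𝓘₂⊆I₂; ∣𝓨₂∣≡L to ∣𝓘₂∣≡L;
              𝓧₀⊕𝓨₂∩X₂⊕Y₂≡∅ to 𝓙₀⊕𝓘₂∩J₂⊕I₂≡∅)
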